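{- Let $G$ be a connected graph, $\tau$ an MVD-coloring of $G$, and $S\subseteq V(G)$. Then the restriction of $\tau$ to the induced subgraph $G[S]$ is an MVD-coloring of $G[S]$.
   Context: For a graph $G$ and a vertex-coloring $\tau$ of $V(G)$ (adjacent vertices may receive the same color), a vertex set is monochromatic if all its vertices have the same color. For distinct vertices $x,y$, an $x$-$y$ vertex cut is a set $D\subseteq V(G)\setminus\{x,y\}$ such that $x$ and $y$ lie in different components of $G-D$. $\tau$ is an MVD-coloring of $G$ if every two nonadjacent vertices $x,y$ of $G$ have a monochromatic $x$-$y$ vertex cut. $G[S]$ denotes the subgraph induced by $S$. -}

module Defs where

open import Level using (0ℓ)
open import Data.Product using (Σ; Σ-syntax; ∃; _×_; _,_; proj₁)
open import Data.Empty using (⊥)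
open import Relation.Nullary using (¬_)
open import Relation.Unary using (Pred; ∁)
open import Relation.Binary.PropositionalEquality using (_≡_; _≢_)

record Graph (V : Set) : Set₁ where
  field
    Adj        : V → V → Set
    Adj-sym    : ∀ {x y} → Adj x y → Adj y x
    Adj-irrefl : ∀ {x} → ¬ Adj x x
open Graph public

data Walk {V : Set} (G : Graph V) : V → V → Set where
  []  : ∀ {x} → Walk G x x
  _∷_ : ∀ {x y z} → Adj G x y → Walk G y z → Walk G x z

Connected : {V : Set} → Graph V → Set
Connected G = ∀ x y → Walk G x y

induced : {V : Set} → Graph V → (S : Pred V 0ℓ) → Graph (Σ V S)
induced G S = record
  { Adj        = λ u v → Adj G (proj₁ u) (proj₁ v)
  ; Adj-sym    = Adj-sym G
  ; Adj-irrefl = Adj-irrefl G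
  }

-- D is an x-y vertex cut: D ⊆ V ∖ {x,y} and x, y lie in different
-- components of G - D (= G[V ∖ D]), i.e. no walk from x to y in G - D.
IsVertexCut : {V : Set} → Graph V → V → V → Pred V 0ℓ → Set
IsVertexCut G x y D =
  Σ (¬ D x) λ x∉D → Σ (¬ D y) λ y∉D →
    ¬ Walk (induced G (∁ D)) (x , x∉D) (y , y∉D)

Monochromatic : {V C : Set} → (V → C) → Pred V 0ℓ → Set
Monochromatic τ D = ∀ u v → D u → D v → τ u ≡ τ v

IsMVDColoring : {V C : Set} → Graph V → (V → C) → Set₁
IsMVDColoring {V} G τ =
  ∀ x y → x ≢ y → ¬ Adj G x y →
    Σ[ D ∈ Pred V 0ℓ ] (IsVertexCut G x y D × Monochromatic τ D)

-- Cuts in G restrict to cuts in G[S]: a walk in G[S] avoiding D is a walk in G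
-- avoiding D, and restricting D to S keeps it monochromatic. Two vertices of
-- G[S] are distinct and nonadjacent exactly when they are so in G, because
-- membership in S is proof-irrelevant.
module Submission where

open import Defs
open import Data.Nat using (ℕ)
open import Data.Fin using (Fin)
open import Data.Fin.Subset using (Subset; _∈_)
open import Data.Product using (Σ; _,_; proj₁)
open import Data.Vec.Properties.WithK using ([]=-irrelevant)
open import Function using (_∘_)
open import Level using (0ℓ)
open import Relation.Binary.PropositionalEquality using (_≢_; refl; cong)
open import Relation.Unary using (Pred; ∁; Irrelevant)

module _ {V W : Set} {G : Graph V} {H : Graph W} (f : V → W)
         (f-adj : ∀ {u v} → Adj G u v → Adj H (f u) (f v)) where

  Walk-map : ∀ {u v} → Walk G u v → Walk H (f u) (f v)
  Walk-map []      = []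
  Walk-map (e ∷ w) = f-adj e ∷ Walk-map w

module _ {V : Set} (G : Graph V) (S : Pred V 0ℓ) where

  IsVertexCut-induced : ∀ {x y D} (x∈S : S x) (y∈S : S y) → IsVertexCut G x y D →
    IsVertexCut (induced G S) (x , x∈S) (y , y∈S) (D ∘ proj₁)
  IsVertexCut-induced {D = D} _ _ (x∉D , y∉D , disconnected) =
    x∉D , y∉D , disconnected ∘ Walk-map forget (λ e → e)
    where
    forget : Σ (Σ V S) (∁ (D ∘ proj₁)) → Σ V (∁ D)
    forget ((v , _) , v∉D) = v , v∉D

Monochromatic-∘ : {V W C : Set} {τ : W → C} {D : Pred W 0ℓ} (f : V → W) →
  Monochromatic τ D → Monochromatic (τ ∘ f) (D ∘ f)
Monochromatic-∘ f mono u v = mono (f u) (f v)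

IsMVDColoring-induced : {V C : Set} (G : Graph V) (τ : V → C) (S : Pred V 0ℓ) →
  Irrelevant S → IsMVDColoring G τ → IsMVDColoring (induced G S) (τ ∘ proj₁)
IsMVDColoring-induced G τ S S-irrelevant mvd (x , x∈S) (y , y∈S) x≢y nonadjacent
  with mvd x y x≢y′ nonadjacent
  where
  x≢y′ : x ≢ y
  x≢y′ refl = x≢y (cong (x ,_) (S-irrelevant x∈S y∈S))
... | D , cut , mono =
  D ∘ proj₁ , IsVertexCut-induced G S x∈S y∈S cut , Monochromatic-∘ proj₁ mono

lemma2p3 : {n : ℕ} {C : Set} (G : Graph (Fin n)) (τ : Fin n → C) (S : Subset n) →
    Connected G → IsMVDColoring G τ →
    IsMVDColoring (induced G (λ v → v ∈ S)) (τ ∘ proj₁)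
lemma2p3 G τ S _ = IsMVDColoring-induced G τ (_∈ S) []=-irrelevant
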